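{- Let $d\ge 1$, $k=2^d-1$, and let $$X=\{\mathbf{0}\}\cup\Big(\big\{(x_1,\dots,x_d,(4k)^{\sum_{i=1}^{d}2^{i-1}x_i}) : x_i\in\{0,1\}\ \forall i\in[d]\big\}\setminus\{(0,\dots,0,1)\}\Big)\subseteq\mathbb{Z}^{d+1},$$ written as $X=\{a_0,a_1,\dots,a_k\}$ with $a_0=\mathbf{0}$ and $\|a_i\|_\infty=(4k)^i$ for $i\in[k]$. Let $P=\mathrm{conv}(X)$ and $t=\sum_{i=0}^k a_i$. Then the representation $t=\sum_{i=1}^k a_i$ is the unique representation of $t$ as a nonnegative integer combination of integer points of $P$, up to arbitrarily adding copies of $a_0$; that is, each of the $2^d-1$ points $a_1,\dots,a_k$ must be used exactly once.
   Context: $\mathrm{conv}(X)$ denotes the convex hull of $X$; $\mathbf{0}$ is the zero vector in $\mathbb{Z}^{d+1}$. -}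

module Defs where

open import Data.Nat as ℕ using (ℕ; zero; suc)
open import Data.Bool using (Bool; true; false)
open import Data.Fin using (Fin)
open import Data.Integer as ℤ using (ℤ; +_)
open import Data.Rational as ℚ using (ℚ; 0ℚ; 1ℚ)
open import Data.Vec as V using (Vec; []; _∷_; _∷ʳ_)
open import Data.Vec.Properties using (≡-dec)
open import Data.List as L using (List; length)
open import Data.List.Membership.Propositional using (_∈_)
open import Data.Product using (Σ; _×_)
open import Relation.Nullary.Decidable using (¬?)
open import Relation.Binary.PropositionalEquality using (_≡_)

kOf : ℕ → ℕ
kOf d = 2 ℕ.^ d ℕ.∸ 1

-- Σ_{i=1}^d 2^{i-1} x_i  (x_1 is the head of the vector)
binVal : ∀ {d} → Vec Bool d → ℕ
binVal [] = 0
binVal (false ∷ xs) = 2 ℕ.* binVal xs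
binVal (true ∷ xs) = 1 ℕ.+ 2 ℕ.* binVal xs

b2z : Bool → ℤ
b2z false = + 0
b2z true = + 1

liftPt : ∀ d → Vec Bool d → Vec ℤ (suc d)
liftPt d x = V.map b2z x ∷ʳ (+ ((4 ℕ.* kOf d) ℕ.^ binVal x))

allBoolVecs : ∀ d → List (Vec Bool d)
allBoolVecs zero = [] L.∷ L.[]
allBoolVecs (suc d) = L.map (false ∷_) (allBoolVecs d) L.++ L.map (true ∷_) (allBoolVecs d)

zeroV : ∀ n → Vec ℤ n
zeroV n = V.replicate n (+ 0)

eLast : ∀ d → Vec ℤ (suc d)
eLast d = zeroV d ∷ʳ + 1

Xlist : ∀ d → List (Vec ℤ (suc d))
Xlist d = zeroV (suc d) L.∷
  L.filter (λ p → ¬? (≡-dec ℤ._≟_ p (eLast d))) (L.map (liftPt d) (allBoolVecs d))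

_+ᵥ_ : ∀ {n} → Vec ℤ n → Vec ℤ n → Vec ℤ n
_+ᵥ_ = V.zipWith ℤ._+_

vsum : ∀ {n} → List (Vec ℤ n) → Vec ℤ n
vsum {n} = L.foldr _+ᵥ_ (zeroV n)

tOf : ∀ d → Vec ℤ (suc d)
tOf d = vsum (Xlist d)

sumℚ : ∀ {m} → (Fin m → ℚ) → ℚ
sumℚ {zero} c = 0ℚ
sumℚ {suc m} c = c Fin.zero ℚ.+ sumℚ (λ j → c (Fin.suc j))
  where import Data.Fin as Fin

-- p ∈ conv(pts) (convex hull over ℚ, equivalently ℝ for rational data, of a finite point family)
InConv : ∀ {m n} → (Fin m → Vec ℤ n) → Vec ℤ n → Set
InConv {m} {n} pts p =
  Σ (Fin m → ℚ) λ c →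
    ((j : Fin m) → 0ℚ ℚ.≤ c j) ×
    (sumℚ c ≡ 1ℚ) ×
    ((r : Fin n) → sumℚ (λ j → c j ℚ.* (V.lookup (pts j) r ℚ./ 1)) ≡ (V.lookup p r ℚ./ 1))

InP : ∀ d → Vec ℤ (suc d) → Set
InP d p = InConv (L.lookup (Xlist d)) p

countOcc : ∀ {n} → Vec ℤ n → List (Vec ℤ n) → ℕ
countOcc q ps = length (L.filter (λ p → ≡-dec ℤ._≟_ p q) ps)

{-# OPTIONS --safe #-}
module Submission where

-- Integer points of P = conv(X) lie in X: the first d coordinates of the points of X are 0/1
-- and determine the point, and if a convex combination of 0/1 values is an integer, every value
-- carrying positive weight equals it.
-- So a representation of t is a multiset of points a_e = (x, w e) with e = binVal x, w 0 = 0
-- and w e = (4k)^e otherwise; let c_e be the multiplicity of a_e. The last coordinate reads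
-- Σ_e c_e w e = Σ_{e=1}^{k} (4k)^e. For e ≥ 1 some coordinate j of a_e is 1 and coordinate j
-- of t is at most 2^d = k + 1, so c_e ≤ k + 1 < 4k, and uniqueness of base-4k expansions
-- forces c_e = 1.

open import Defs
open import Data.Nat using (ℕ; suc; _≥_)
open import Data.Integer using (ℤ)
open import Data.Vec using (Vec)
open import Data.List using (List)
open import Data.List.Relation.Unary.All using (All)
open import Data.List.Membership.Propositional using (_∈_)
open import Data.Product using (_×_)
open import Relation.Nullary using (¬_)
open import Relation.Binary.PropositionalEquality using (_≡_)

open import Data.Bool as Bool using (Bool; true; false)
open import Data.Empty using (⊥-elim)
open import Data.Fin as Fin using (Fin; inject₁; fromℕ)
open import Data.Integer as ℤ using (0ℤ; 1ℤ)
import Data.Integer.Properties as ℤP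
open import Data.List as List using (length; filter; map; []; _∷_; _++_)
open import Data.List.Membership.Propositional.Properties using (∈-map⁻; ∈-lookup)
import Data.List.Properties as ListP
import Data.List.Relation.Unary.All as All
import Data.List.Relation.Unary.All.Properties as AllP
open import Data.Nat as ℕ using (zero; _+_; _*_; _^_; _≤_; _<_; z≤n; s≤s; z<s; s<s; NonZero)
open import Data.List.Membership.DecPropositional ℕ._≟_ using (_∈?_)
import Data.Nat.Coprimality as Coprime
open import Data.Nat.DivMod using (_%_; [m+kn]%n≡m%n; m<n⇒m%n≡m)
open import Data.Nat.ListAction using (sum)
open import Data.Nat.ListAction.Properties using (sum-++)
open import Data.Nat.Properties as ℕP
  using ( +-identityʳ; *-identityˡ; *-identityʳ; *-zeroʳ; *-comm; *-assoc; *-suc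
        ; +-cancelˡ-≡; *-cancelʳ-≡)
open import Algebra.Properties.CommutativeSemigroup ℕP.+-commutativeSemigroup using (interchange)
open import Data.Product using (∃; _,_; proj₁; proj₂)
open import Data.Rational as ℚ using (ℚ; mkℚ; 0ℚ; 1ℚ; ↥_)
import Data.Rational.Properties as ℚP
open import Data.Sum using (_⊎_; inj₁; inj₂)
open import Data.Vec as Vec using ([]; _∷_; _∷ʳ_)
import Data.Vec.Properties as VecP
open import Data.Vec.Properties using (≡-dec)
open import Function using (_∘_)
open import Function.Definitions using (Injective)
open import Relation.Binary.Definitions using (DecidableEquality)
open import Relation.Binary.PropositionalEquality
  using (_≢_; refl; sym; trans; cong; cong₂; subst; subst₂; module ≡-Reasoning)
open import Relation.Nullary using (Dec; does; yes; no)
open import Relation.Nullary.Decidable using (¬?)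

private variable
  m n : ℕ

fromℤ : ℤ → ℚ
fromℤ z = z ℚ./ 1

fromℤ≡mkℚ : ∀ z → fromℤ z ≡ mkℚ z 0 (Coprime.sym (Coprime.1-coprimeTo ℤ.∣ z ∣))
fromℤ≡mkℚ z = ℚP.↥p/↧p≡p (mkℚ z 0 _)

fromℤ-injective : ∀ {a b} → fromℤ a ≡ fromℤ b → a ≡ b
fromℤ-injective {a} {b} eq = cong ↥_ (trans (sym (fromℤ≡mkℚ a)) (trans eq (fromℤ≡mkℚ b)))

fromℤ-cancel-≤ : ∀ {a b} → fromℤ a ℚ.≤ fromℤ b → a ℤ.≤ b
fromℤ-cancel-≤ {a} {b} a≤b = subst₂ ℤ._≤_ (ℤP.*-identityʳ a) (ℤP.*-identityʳ b)
  (ℚP.drop-*≤* (subst₂ ℚ._≤_ (fromℤ≡mkℚ a) (fromℤ≡mkℚ b) a≤b))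

IsBit : ℤ → Set
IsBit z = z ≡ 0ℤ ⊎ z ≡ 1ℤ

0≤z≤1⇒IsBit : ∀ {z} → 0ℤ ℤ.≤ z → z ℤ.≤ 1ℤ → IsBit z
0≤z≤1⇒IsBit {ℤ.+ 0}             _ _                   = inj₁ refl
0≤z≤1⇒IsBit {ℤ.+ 1}             _ _                   = inj₂ refl
0≤z≤1⇒IsBit {ℤ.+ suc (suc _)}   _ (ℤ.+≤+ (s≤s ()))
0≤z≤1⇒IsBit {ℤ.-[1+ _ ]}        () _

sumℚ-cong : ∀ {f g : Fin m → ℚ} → (∀ i → f i ≡ g i) → sumℚ f ≡ sumℚ g
sumℚ-cong {zero}  f≡g = refl
sumℚ-cong {suc m} f≡g = cong₂ ℚ._+_ (f≡g Fin.zero) (sumℚ-cong (f≡g ∘ Fin.suc))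

sumℚ-zero : ∀ m → sumℚ {m} (λ _ → 0ℚ) ≡ 0ℚ
sumℚ-zero zero    = refl
sumℚ-zero (suc m) = cong (0ℚ ℚ.+_) (sumℚ-zero m)

*-distribʳ-sumℚ : ∀ (f : Fin m → ℚ) q → sumℚ f ℚ.* q ≡ sumℚ (λ i → f i ℚ.* q)
*-distribʳ-sumℚ {zero}  f q = ℚP.*-zeroˡ q
*-distribʳ-sumℚ {suc m} f q = trans (ℚP.*-distribʳ-+ q (f Fin.zero) _)
  (cong (f Fin.zero ℚ.* q ℚ.+_) (*-distribʳ-sumℚ (f ∘ Fin.suc) q))

sumℚ-mono-≤ : ∀ {f g : Fin m → ℚ} → (∀ i → f i ℚ.≤ g i) → sumℚ f ℚ.≤ sumℚ g
sumℚ-mono-≤ {zero}  f≤g = ℚP.≤-refl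
sumℚ-mono-≤ {suc m} f≤g = ℚP.+-mono-≤ (f≤g Fin.zero) (sumℚ-mono-≤ (f≤g ∘ Fin.suc))

+-mono-≤-≡⇒≡ : ∀ {a b s t} → a ℚ.≤ b → s ℚ.≤ t → a ℚ.+ s ≡ b ℚ.+ t → a ≡ b × s ≡ t
+-mono-≤-≡⇒≡ {a} {b} {s} {t} a≤b s≤t eq with a ℚP.<? b | s ℚP.<? t
... | yes a<b | _       = ⊥-elim (ℚP.<⇒≢ (ℚP.+-mono-<-≤ a<b s≤t) eq)
... | no _    | yes s<t = ⊥-elim (ℚP.<⇒≢ (ℚP.+-mono-≤-< a≤b s<t) eq)
... | no a≮b  | no s≮t  = ℚP.≤-antisym a≤b (ℚP.≮⇒≥ a≮b) , ℚP.≤-antisym s≤t (ℚP.≮⇒≥ s≮t)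

sumℚ-mono-≤-≡⇒≡ : ∀ {f g : Fin m → ℚ} → (∀ i → f i ℚ.≤ g i) → sumℚ f ≡ sumℚ g → ∀ i → f i ≡ g i
sumℚ-mono-≤-≡⇒≡ {suc m} f≤g eq i with +-mono-≤-≡⇒≡ (f≤g Fin.zero) (sumℚ-mono-≤ (f≤g ∘ Fin.suc)) eq
sumℚ-mono-≤-≡⇒≡ {suc m} f≤g eq Fin.zero    | head≡ , _ = head≡
sumℚ-mono-≤-≡⇒≡ {suc m} f≤g eq (Fin.suc i) | _ , tail≡ = sumℚ-mono-≤-≡⇒≡ (f≤g ∘ Fin.suc) tail≡ i

sumℚ≢0⇒∃≢0 : ∀ (c : Fin m → ℚ) → sumℚ c ≢ 0ℚ → ∃ λ i → c i ≢ 0ℚ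
sumℚ≢0⇒∃≢0 {zero}  c sum≢0 = ⊥-elim (sum≢0 refl)
sumℚ≢0⇒∃≢0 {suc m} c sum≢0 with c Fin.zero ℚP.≟ 0ℚ
... | no  c₀≢0 = Fin.zero , c₀≢0
... | yes c₀≡0 with sumℚ≢0⇒∃≢0 (c ∘ Fin.suc) (λ tail≡0 → sum≢0 (cong₂ ℚ._+_ c₀≡0 tail≡0))
...   | i , cᵢ≢0 = Fin.suc i , cᵢ≢0

integral-bit-average⇒support-constant :
  ∀ (c : Fin m → ℚ) (v : Fin m → ℤ) {p} →
  (∀ i → 0ℚ ℚ.≤ c i) → sumℚ c ≡ 1ℚ → (∀ i → IsBit (v i)) →
  sumℚ (λ i → c i ℚ.* fromℤ (v i)) ≡ fromℤ p →
  ∀ i → c i ≢ 0ℚ → v i ≡ p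
integral-bit-average⇒support-constant {m} c v {p} c≥0 ∑c≡1 bits ∑f≡p = support
  where
  f : Fin m → ℚ
  f i = c i ℚ.* fromℤ (v i)

  scaled : ∀ i → (v i ≡ 0ℤ × f i ≡ 0ℚ) ⊎ (v i ≡ 1ℤ × f i ≡ c i)
  scaled i with v i | bits i
  ... | _ | inj₁ refl = inj₁ (refl , ℚP.*-zeroʳ (c i))
  ... | _ | inj₂ refl = inj₂ (refl , ℚP.*-identityʳ (c i))

  0≤f : ∀ i → 0ℚ ℚ.≤ f i
  0≤f i with scaled i
  ... | inj₁ (_ , fᵢ≡0)  = ℚP.≤-reflexive (sym fᵢ≡0)
  ... | inj₂ (_ , fᵢ≡cᵢ) = subst (0ℚ ℚ.≤_) (sym fᵢ≡cᵢ) (c≥0 i)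

  f≤c : ∀ i → f i ℚ.≤ c i
  f≤c i with scaled i
  ... | inj₁ (_ , fᵢ≡0)  = subst (ℚ._≤ c i) (sym fᵢ≡0) (c≥0 i)
  ... | inj₂ (_ , fᵢ≡cᵢ) = ℚP.≤-reflexive fᵢ≡cᵢ

  p-bit : IsBit p
  p-bit = 0≤z≤1⇒IsBit
    (fromℤ-cancel-≤ (subst₂ ℚ._≤_ (sumℚ-zero m) ∑f≡p (sumℚ-mono-≤ 0≤f)))
    (fromℤ-cancel-≤ (subst₂ ℚ._≤_ ∑f≡p ∑c≡1 (sumℚ-mono-≤ f≤c)))

  p≡0⇒f≡0 : p ≡ 0ℤ → ∀ i → 0ℚ ≡ f i
  p≡0⇒f≡0 p≡0 = sumℚ-mono-≤-≡⇒≡ 0≤f (trans (sumℚ-zero m) (sym (trans ∑f≡p (cong fromℤ p≡0))))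

  p≡1⇒f≡c : p ≡ 1ℤ → ∀ i → f i ≡ c i
  p≡1⇒f≡c p≡1 = sumℚ-mono-≤-≡⇒≡ f≤c (trans ∑f≡p (trans (cong fromℤ p≡1) (sym ∑c≡1)))

  support : ∀ i → c i ≢ 0ℚ → v i ≡ p
  support i cᵢ≢0 with p-bit | scaled i
  ... | inj₁ p≡0 | inj₁ (vᵢ≡0 , _)   = trans vᵢ≡0 (sym p≡0)
  ... | inj₂ p≡1 | inj₂ (vᵢ≡1 , _)   = trans vᵢ≡1 (sym p≡1)
  ... | inj₁ p≡0 | inj₂ (_ , fᵢ≡cᵢ) = ⊥-elim (cᵢ≢0 (trans (sym fᵢ≡cᵢ) (sym (p≡0⇒f≡0 p≡0 i))))
  ... | inj₂ p≡1 | inj₁ (_ , fᵢ≡0)  = ⊥-elim (cᵢ≢0 (trans (sym (p≡1⇒f≡c p≡1 i)) fᵢ≡0))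

lookup-injective : ∀ {A : Set} {u w : Vec A n} → (∀ r → Vec.lookup u r ≡ Vec.lookup w r) → u ≡ w
lookup-injective {u = u} {w} u≗w =
  trans (sym (VecP.tabulate∘lookup u)) (trans (VecP.tabulate-cong u≗w) (VecP.tabulate∘lookup w))

InConv-bitDetermined⇒point :
  ∀ {k} (pts : Fin m → Vec ℤ n) (coord : Fin k → Fin n) {p} →
  (∀ i j → IsBit (Vec.lookup (pts i) (coord j))) →
  (∀ i i′ → (∀ j → Vec.lookup (pts i) (coord j) ≡ Vec.lookup (pts i′) (coord j)) → pts i ≡ pts i′) →
  InConv pts p → ∃ λ i → pts i ≡ p
InConv-bitDetermined⇒point {m} {n} pts coord {p} bits determined (c , c≥0 , ∑c≡1 , ∑cpts≡p) =
  i₀ , lookup-injective lookup-pts-i₀≡p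
  where
  i₀,cᵢ₀≢0 : ∃ λ i → c i ≢ 0ℚ
  i₀,cᵢ₀≢0 = sumℚ≢0⇒∃≢0 c (λ ∑c≡0 → ℚP.1≢0 (trans (sym ∑c≡1) ∑c≡0))

  i₀ : Fin m
  i₀ = proj₁ i₀,cᵢ₀≢0

  a : Fin m → Fin n → ℤ
  a i r = Vec.lookup (pts i) r

  support≡i₀ : ∀ i → c i ≢ 0ℚ → pts i ≡ pts i₀
  support≡i₀ i cᵢ≢0 = determined i i₀ λ j →
    let agree = integral-bit-average⇒support-constant c (λ i → a i (coord j))
                  {Vec.lookup p (coord j)} c≥0 ∑c≡1 (λ i → bits i j) (∑cpts≡p (coord j))
    in trans (agree i cᵢ≢0) (sym (agree i₀ (proj₂ i₀,cᵢ₀≢0)))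

  lookup-pts-i₀≡p : ∀ r → a i₀ r ≡ Vec.lookup p r
  lookup-pts-i₀≡p r = fromℤ-injective (begin
    fromℤ (a i₀ r)                       ≡⟨ ℚP.*-identityˡ _ ⟨
    1ℚ ℚ.* fromℤ (a i₀ r)                ≡⟨ cong (ℚ._* fromℤ (a i₀ r)) ∑c≡1 ⟨
    sumℚ c ℚ.* fromℤ (a i₀ r)            ≡⟨ *-distribʳ-sumℚ c _ ⟩
    sumℚ (λ i → c i ℚ.* fromℤ (a i₀ r))  ≡⟨ sumℚ-cong support-term ⟩
    sumℚ (λ i → c i ℚ.* fromℤ (a i r))   ≡⟨ ∑cpts≡p r ⟩
    fromℤ (Vec.lookup p r)               ∎)
    where
    open ≡-Reasoning
    support-term : ∀ i → c i ℚ.* fromℤ (a i₀ r) ≡ c i ℚ.* fromℤ (a i r)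
    support-term i with c i ℚP.≟ 0ℚ
    ... | yes cᵢ≡0 rewrite cᵢ≡0 =
      trans (ℚP.*-zeroˡ (fromℤ (a i₀ r))) (sym (ℚP.*-zeroˡ (fromℤ (a i r))))
    ... | no  cᵢ≢0 = cong (λ q → c i ℚ.* fromℤ (Vec.lookup q r)) (sym (support≡i₀ i cᵢ≢0))

bit : Bool → ℕ
bit false = 0
bit true  = 1

bit≤1 : ∀ b → bit b ≤ 1
bit≤1 false = z≤n
bit≤1 true  = s≤s z≤n

sumBelow : ℕ → (ℕ → ℕ) → ℕ
sumBelow zero    f = 0
sumBelow (suc n) f = f 0 + sumBelow n (f ∘ suc)

sumBelow-cong : ∀ n {f g : ℕ → ℕ} → (∀ e → f e ≡ g e) → sumBelow n f ≡ sumBelow n g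
sumBelow-cong zero    f≡g = refl
sumBelow-cong (suc n) f≡g = cong₂ _+_ (f≡g 0) (sumBelow-cong n (f≡g ∘ suc))

sumBelow-zero : ∀ n → sumBelow n (λ _ → 0) ≡ 0
sumBelow-zero zero    = refl
sumBelow-zero (suc n) = sumBelow-zero n

sumBelow-one : ∀ n → sumBelow n (λ _ → 1) ≡ n
sumBelow-one zero    = refl
sumBelow-one (suc n) = cong suc (sumBelow-one n)

sumBelow-distrib-+ : ∀ n (f g : ℕ → ℕ) →
  sumBelow n (λ e → f e + g e) ≡ sumBelow n f + sumBelow n g
sumBelow-distrib-+ zero    f g = refl
sumBelow-distrib-+ (suc n) f g = trans
  (cong (λ s → f 0 + g 0 + s) (sumBelow-distrib-+ n (f ∘ suc) (g ∘ suc)))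
  (interchange (f 0) (g 0) _ _)

*-distribʳ-sumBelow : ∀ n (f : ℕ → ℕ) M → sumBelow n f * M ≡ sumBelow n (λ e → f e * M)
*-distribʳ-sumBelow zero    f M = refl
*-distribʳ-sumBelow (suc n) f M = trans (ℕP.*-distribʳ-+ M (f 0) _)
  (cong (f 0 * M +_) (*-distribʳ-sumBelow n (f ∘ suc) M))

sumBelow-even-odd : ∀ n (g : ℕ → ℕ) →
  sumBelow (2 * n) g ≡ sumBelow n (λ e → g (2 * e)) + sumBelow n (λ e → g (suc (2 * e)))
sumBelow-even-odd zero    g = refl
sumBelow-even-odd (suc n) g = begin
  sumBelow (2 * suc n) g
    ≡⟨ cong (λ m → sumBelow m g) (*-suc 2 n) ⟩
  g 0 + (g 1 + sumBelow (2 * n) (g ∘ suc ∘ suc))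
    ≡⟨ cong (λ s → g 0 + (g 1 + s)) (sumBelow-even-odd n (g ∘ suc ∘ suc)) ⟩
  g 0 + (g 1 + (sumBelow n (λ e → g (2 + 2 * e)) + sumBelow n (λ e → g (3 + 2 * e))))
    ≡⟨ trans (sym (ℕP.+-assoc (g 0) (g 1) _)) (interchange (g 0) (g 1) _ _) ⟩
  (g 0 + sumBelow n (λ e → g (2 + 2 * e))) + (g 1 + sumBelow n (λ e → g (3 + 2 * e)))
    ≡⟨ cong₂ (λ s t → (g 0 + s) + (g 1 + t))
         (sumBelow-cong n (λ e → cong g (sym (*-suc 2 e))))
         (sumBelow-cong n (λ e → cong (g ∘ suc) (sym (*-suc 2 e)))) ⟩
  sumBelow (suc n) (λ e → g (2 * e)) + sumBelow (suc n) (λ e → g (suc (2 * e)))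
    ∎
  where open ≡-Reasoning

sumBelow-indicator : ∀ n (h : ℕ → ℕ) {b} → b < n → sumBelow n (λ e → bit (does (b ℕ.≟ e)) * h e) ≡ h b
sumBelow-indicator (suc n) h {zero} _ =
  trans (cong (1 * h 0 +_) (sumBelow-zero n)) (trans (+-identityʳ _) (*-identityˡ _))
sumBelow-indicator (suc n) h {suc b} (s<s b<n) = sumBelow-indicator n (h ∘ suc) b<n

+-*-digit-injective : ∀ M .{{_ : NonZero M}} {a b x y} → a < M → b < M →
  a + x * M ≡ b + y * M → a ≡ b × x ≡ y
+-*-digit-injective M {a} {b} {x} {y} a<M b<M eq = a≡b , *-cancelʳ-≡ x y M (+-cancelˡ-≡ a _ _ eq′)
  where
  a≡b : a ≡ b
  a≡b = begin
    a                ≡⟨ m<n⇒m%n≡m a<M ⟨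
    a % M            ≡⟨ [m+kn]%n≡m%n a x M ⟨
    (a + x * M) % M  ≡⟨ cong (_% M) eq ⟩
    (b + y * M) % M  ≡⟨ [m+kn]%n≡m%n b y M ⟩
    b % M            ≡⟨ m<n⇒m%n≡m b<M ⟩
    b                ∎
    where open ≡-Reasoning
  eq′ : a + x * M ≡ a + y * M
  eq′ = trans eq (cong (λ c → c + y * M) (sym a≡b))

sumBelow-*-^suc : ∀ M n (a : ℕ → ℕ) →
  sumBelow n (λ e → a e * M ^ suc e) ≡ sumBelow n (λ e → a e * M ^ e) * M
sumBelow-*-^suc M n a = trans
  (sumBelow-cong n (λ e → trans (cong (a e *_) (*-comm M (M ^ e))) (sym (*-assoc (a e) (M ^ e) M))))
  (sym (*-distribʳ-sumBelow n (λ e → a e * M ^ e) M))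

base-digits-injective : ∀ M .{{_ : NonZero M}} n {a b : ℕ → ℕ} →
  (∀ e → e < n → a e < M) → (∀ e → e < n → b e < M) →
  sumBelow n (λ e → a e * M ^ e) ≡ sumBelow n (λ e → b e * M ^ e) →
  ∀ e → e < n → a e ≡ b e
base-digits-injective M (suc n) {a} {b} a<M b<M eq = digit
  where
  expand : ∀ c → sumBelow (suc n) (λ e → c e * M ^ e) ≡ c 0 + sumBelow n (λ e → c (suc e) * M ^ e) * M
  expand c = cong₂ _+_ (*-identityʳ (c 0)) (sumBelow-*-^suc M n (c ∘ suc))

  split : a 0 ≡ b 0 × sumBelow n (λ e → a (suc e) * M ^ e) ≡ sumBelow n (λ e → b (suc e) * M ^ e)
  split = +-*-digit-injective M (a<M 0 z<s) (b<M 0 z<s) (trans (sym (expand a)) (trans eq (expand b)))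

  digit : ∀ e → e < suc n → a e ≡ b e
  digit zero    _         = proj₁ split
  digit (suc e) (s<s e<n) =
    base-digits-injective M n (λ e → a<M (suc e) ∘ s<s) (λ e → b<M (suc e) ∘ s<s) (proj₂ split) e e<n

weight : ℕ → ℕ → ℕ
weight M zero    = 0
weight M (suc e) = M ^ suc e

weighted-digits-injective : ∀ M .{{_ : NonZero M}} n {a b : ℕ → ℕ} →
  (∀ e → suc e < n → a (suc e) < M) → (∀ e → suc e < n → b (suc e) < M) →
  sumBelow n (λ e → a e * weight M e) ≡ sumBelow n (λ e → b e * weight M e) →
  ∀ e → suc e < n → a (suc e) ≡ b (suc e)
weighted-digits-injective M (suc n) {a} {b} a<M b<M eq e (s<s e<n) =
  base-digits-injective M n (λ e → a<M e ∘ s<s) (λ e → b<M e ∘ s<s)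
    (*-cancelʳ-≡ _ _ M (trans (sym (drop-weight₀ a)) (trans eq (drop-weight₀ b)))) e e<n
  where
  drop-weight₀ : ∀ c →
    sumBelow (suc n) (λ e → c e * weight M e) ≡ sumBelow n (λ e → c (suc e) * M ^ e) * M
  drop-weight₀ c = trans (cong (_+ sumBelow n (λ e → c (suc e) * M ^ suc e)) (*-zeroʳ (c 0)))
                         (sumBelow-*-^suc M n (c ∘ suc))

2≤n⇒n<4*[n∸1] : ∀ {n} → 2 ≤ n → n < 4 * (n ℕ.∸ 1)
2≤n⇒n<4*[n∸1] {suc (suc t)} (s≤s (s≤s z≤n)) =
  subst (2 + t <_) (sym (*-suc 4 t)) (ℕP.+-mono-<-≤ {2} {4} (s<s (s<s z<s)) (ℕP.m≤n*m t 4))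

count : ∀ {A : Set} → DecidableEquality A → A → List A → ℕ
count _≟_ y xs = length (filter (_≟ y) xs)

count-∷ : ∀ {A : Set} (_≟_ : DecidableEquality A) y x xs →
  count _≟_ y (x ∷ xs) ≡ bit (does (x ≟ y)) + count _≟_ y xs
count-∷ _≟_ y x xs with does (x ≟ y)
... | true  = refl
... | false = refl

count-map-injective : ∀ {A B : Set} (_≟ᴬ_ : DecidableEquality A) (_≟ᴮ_ : DecidableEquality B)
  {f : A → B} → Injective _≡_ _≡_ f → ∀ y xs → count _≟ᴮ_ (f y) (map f xs) ≡ count _≟ᴬ_ y xs
count-map-injective _≟ᴬ_ _≟ᴮ_ {f} f-inj y []       = refl
count-map-injective _≟ᴬ_ _≟ᴮ_ {f} f-inj y (x ∷ xs) with f x ≟ᴮ f y | x ≟ᴬ y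
... | yes _     | yes _   = cong suc (count-map-injective _≟ᴬ_ _≟ᴮ_ f-inj y xs)
... | no _      | no _    = count-map-injective _≟ᴬ_ _≟ᴮ_ f-inj y xs
... | yes fx≡fy | no x≢y  = ⊥-elim (x≢y (f-inj fx≡fy))
... | no fx≢fy  | yes x≡y = ⊥-elim (fx≢fy (cong f x≡y))

sum-map-regroup : ∀ n (h : ℕ → ℕ) {es} → All (_< n) es →
  sum (map h es) ≡ sumBelow n (λ e → count ℕ._≟_ e es * h e)
sum-map-regroup n h {[]}     All.[]          = sym (sumBelow-zero n)
sum-map-regroup n h {x ∷ es} (x<n All.∷ es<n) = begin
  h x + sum (map h es)
    ≡⟨ cong₂ _+_ (sym (sumBelow-indicator n h x<n)) (sum-map-regroup n h es<n) ⟩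
  sumBelow n (λ e → bit (does (x ℕ.≟ e)) * h e) + sumBelow n (λ e → count ℕ._≟_ e es * h e)
    ≡⟨ sym (sumBelow-distrib-+ n _ _) ⟩
  sumBelow n (λ e → bit (does (x ℕ.≟ e)) * h e + count ℕ._≟_ e es * h e)
    ≡⟨ sumBelow-cong n (λ e → trans (sym (ℕP.*-distribʳ-+ (h e) (bit (does (x ℕ.≟ e))) _))
                                     (cong (_* h e) (sym (count-∷ ℕ._≟_ e x es)))) ⟩
  sumBelow n (λ e → count ℕ._≟_ e (x ∷ es) * h e)
    ∎
  where open ≡-Reasoning

sum-map-mono-≤ : ∀ {A : Set} {f g : A → ℕ} → (∀ x → f x ≤ g x) → ∀ xs → sum (map f xs) ≤ sum (map g xs)
sum-map-mono-≤ f≤g []       = z≤n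
sum-map-mono-≤ f≤g (x ∷ xs) = ℕP.+-mono-≤ (f≤g x) (sum-map-mono-≤ f≤g xs)

count≤sum-map : ∀ {A : Set} (_≟_ : DecidableEquality A) {f : A → ℕ} {y} → 1 ≤ f y →
  ∀ xs → count _≟_ y xs ≤ sum (map f xs)
count≤sum-map _≟_     1≤fy []       = z≤n
count≤sum-map _≟_ {f} {y} 1≤fy (x ∷ xs) with x ≟ y
... | yes refl = ℕP.+-mono-≤ 1≤fy (count≤sum-map _≟_ 1≤fy xs)
... | no  _    = ℕP.≤-trans (count≤sum-map _≟_ 1≤fy xs) (ℕP.m≤n+m _ (f x))

∉⇒count≡0 : ∀ {A : Set} (_≟_ : DecidableEquality A) {y} xs → ¬ y ∈ xs → count _≟_ y xs ≡ 0
∉⇒count≡0 _≟_ xs y∉xs = cong length (ListP.filter-none (_≟ _)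
  (All.map (λ y≢x x≡y → y≢x (sym x≡y)) (AllP.¬Any⇒All¬ xs y∉xs)))

All-∈-map⇒≡map : ∀ {A B : Set} {f : A → B} {ys ps} → All (_∈ map f ys) ps → ∃ λ xs → ps ≡ map f xs
All-∈-map⇒≡map All.[]         = [] , refl
All-∈-map⇒≡map (p∈ All.∷ ps∈) with ∈-map⁻ _ p∈ | All-∈-map⇒≡map ps∈
... | x , _ , refl | xs , refl = x ∷ xs , refl

lookup-vsum-map : ∀ {A : Set} (f : A → Vec ℤ n) (g : A → ℕ) r →
  (∀ x → Vec.lookup (f x) r ≡ ℤ.+ g x) → ∀ xs → Vec.lookup (vsum (map f xs)) r ≡ ℤ.+ sum (map g xs)
lookup-vsum-map f g r fᵣ≡g []       = VecP.lookup-replicate r 0ℤ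
lookup-vsum-map f g r fᵣ≡g (x ∷ xs) = begin
  Vec.lookup (f x +ᵥ vsum (map f xs)) r
    ≡⟨ VecP.lookup-zipWith ℤ._+_ r (f x) _ ⟩
  Vec.lookup (f x) r ℤ.+ Vec.lookup (vsum (map f xs)) r
    ≡⟨ cong₂ ℤ._+_ (fᵣ≡g x) (lookup-vsum-map f g r fᵣ≡g xs) ⟩
  ℤ.+ g x ℤ.+ ℤ.+ sum (map g xs)
    ≡⟨ ℤP.pos-+ (g x) _ ⟨
  ℤ.+ sum (map g (x ∷ xs))
    ∎
  where open ≡-Reasoning

vsum-map-≡⇒sum-map-≡ : ∀ {A : Set} (f : A → Vec ℤ n) (g : A → ℕ) r →
  (∀ x → Vec.lookup (f x) r ≡ ℤ.+ g x) → ∀ {xs ys} →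
  vsum (map f xs) ≡ vsum (map f ys) → sum (map g xs) ≡ sum (map g ys)
vsum-map-≡⇒sum-map-≡ f g r fᵣ≡g {xs} {ys} eq = ℤP.+-injective (begin
  ℤ.+ sum (map g xs)              ≡⟨ lookup-vsum-map f g r fᵣ≡g xs ⟨
  Vec.lookup (vsum (map f xs)) r  ≡⟨ cong (λ v → Vec.lookup v r) eq ⟩
  Vec.lookup (vsum (map f ys)) r  ≡⟨ lookup-vsum-map f g r fᵣ≡g ys ⟩
  ℤ.+ sum (map g ys)              ∎)
  where open ≡-Reasoning

lookup-∷ʳ-inject₁ : ∀ {A : Set} (xs : Vec A n) a j → Vec.lookup (xs ∷ʳ a) (inject₁ j) ≡ Vec.lookup xs j
lookup-∷ʳ-inject₁ (x ∷ xs) a Fin.zero    = refl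
lookup-∷ʳ-inject₁ (x ∷ xs) a (Fin.suc j) = lookup-∷ʳ-inject₁ xs a j

lookup-∷ʳ-fromℕ : ∀ {A : Set} (xs : Vec A n) a → Vec.lookup (xs ∷ʳ a) (fromℕ n) ≡ a
lookup-∷ʳ-fromℕ []       a = refl
lookup-∷ʳ-fromℕ (x ∷ xs) a = lookup-∷ʳ-fromℕ xs a

replicate-∷ʳ : ∀ {A : Set} n (a : A) → Vec.replicate n a ∷ʳ a ≡ Vec.replicate (suc n) a
replicate-∷ʳ zero    a = refl
replicate-∷ʳ (suc n) a = cong (a ∷_) (replicate-∷ʳ n a)

b2z-injective : Injective _≡_ _≡_ b2z
b2z-injective {false} {false} _ = refl
b2z-injective {true}  {true}  _ = refl

b2z-IsBit : ∀ b → IsBit (b2z b)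
b2z-IsBit false = inj₁ refl
b2z-IsBit true  = inj₂ refl

b2z≡+bit : ∀ b → b2z b ≡ ℤ.+ bit b
b2z≡+bit false = refl
b2z≡+bit true  = refl

map-b2z-injective : Injective _≡_ _≡_ (Vec.map {n = n} b2z)
map-b2z-injective {x = x} {y} eq = lookup-injective λ j → b2z-injective (begin
  b2z (Vec.lookup x j)          ≡⟨ VecP.lookup-map j b2z x ⟨
  Vec.lookup (Vec.map b2z x) j  ≡⟨ cong (λ v → Vec.lookup v j) eq ⟩
  Vec.lookup (Vec.map b2z y) j  ≡⟨ VecP.lookup-map j b2z y ⟩
  b2z (Vec.lookup y j)          ∎)
  where open ≡-Reasoning

_≟ᵇ_ : ∀ {d} → DecidableEquality (Vec Bool d)
_≟ᵇ_ = ≡-dec Bool._≟_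

binVal-injective : ∀ {d} → Injective _≡_ _≡_ (binVal {d})
binVal-injective {x = []}        {[]}        _  = refl
binVal-injective {x = false ∷ x} {false ∷ y} eq =
  cong (false ∷_) (binVal-injective (ℕP.*-cancelˡ-≡ (binVal x) (binVal y) 2 eq))
binVal-injective {x = true ∷ x}  {true ∷ y}  eq =
  cong (true ∷_) (binVal-injective (ℕP.*-cancelˡ-≡ (binVal x) (binVal y) 2 (ℕP.suc-injective eq)))
binVal-injective {x = false ∷ x} {true ∷ y}  eq = ⊥-elim (ℕP.even≢odd (binVal x) (binVal y) eq)
binVal-injective {x = true ∷ x}  {false ∷ y} eq = ⊥-elim (ℕP.even≢odd (binVal y) (binVal x) (sym eq))

binVal<2^d : ∀ {d} (x : Vec Bool d) → binVal x < 2 ^ d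
binVal<2^d []          = z<s
binVal<2^d (false ∷ x) = ℕP.*-monoʳ-< 2 (binVal<2^d x)
binVal<2^d {suc d} (true ∷ x) = subst (_≤ 2 * 2 ^ d) (*-suc 2 (binVal x)) (ℕP.*-monoʳ-≤ 2 (binVal<2^d x))

binVal-replicate-false : ∀ d → binVal (Vec.replicate d false) ≡ 0
binVal-replicate-false zero    = refl
binVal-replicate-false (suc d) = cong (2 *_) (binVal-replicate-false d)

some-bit-set : ∀ {d} (x : Vec Bool d) → x ≢ Vec.replicate d false → ∃ λ j → Vec.lookup x j ≡ true
some-bit-set []          x≢0 = ⊥-elim (x≢0 refl)
some-bit-set (true ∷ x)  _   = Fin.zero , refl
some-bit-set (false ∷ x) x≢0 with some-bit-set x (x≢0 ∘ cong (false ∷_))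
... | j , xⱼ≡true = Fin.suc j , xⱼ≡true

sum-map-binVal-allBoolVecs : ∀ d (g : ℕ → ℕ) →
  sum (map (g ∘ binVal) (allBoolVecs d)) ≡ sumBelow (2 ^ d) g
sum-map-binVal-allBoolVecs zero    g = refl
sum-map-binVal-allBoolVecs (suc d) g = begin
  sum (map (g ∘ binVal) (map (false ∷_) all ++ map (true ∷_) all))
    ≡⟨ cong sum (ListP.map-++ (g ∘ binVal) (map (false ∷_) all) _) ⟩
  sum (map (g ∘ binVal) (map (false ∷_) all) ++ map (g ∘ binVal) (map (true ∷_) all))
    ≡⟨ sum-++ (map (g ∘ binVal) (map (false ∷_) all)) _ ⟩
  sum (map (g ∘ binVal) (map (false ∷_) all)) + sum (map (g ∘ binVal) (map (true ∷_) all))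
    ≡⟨ cong₂ _+_ (cong sum (ListP.map-∘ all)) (cong sum (ListP.map-∘ all)) ⟨
  sum (map (even ∘ binVal) all) + sum (map (odd ∘ binVal) all)
    ≡⟨ cong₂ _+_ (sum-map-binVal-allBoolVecs d even) (sum-map-binVal-allBoolVecs d odd) ⟩
  sumBelow (2 ^ d) even + sumBelow (2 ^ d) odd
    ≡⟨ sumBelow-even-odd (2 ^ d) g ⟨
  sumBelow (2 * 2 ^ d) g
    ∎
  where
  open ≡-Reasoning
  all : List (Vec Bool d)
  all = allBoolVecs d
  even odd : ℕ → ℕ
  even e = g (2 * e)
  odd  e = g (suc (2 * e))

nonzeroBoolVecs : ∀ d → List (Vec Bool d)
nonzeroBoolVecs zero    = []
nonzeroBoolVecs (suc d) = map (false ∷_) (nonzeroBoolVecs d) ++ map (true ∷_) (allBoolVecs d)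

allBoolVecs≡replicate-false∷nonzeroBoolVecs : ∀ d →
  allBoolVecs d ≡ Vec.replicate d false ∷ nonzeroBoolVecs d
allBoolVecs≡replicate-false∷nonzeroBoolVecs zero    = refl
allBoolVecs≡replicate-false∷nonzeroBoolVecs (suc d)
  rewrite allBoolVecs≡replicate-false∷nonzeroBoolVecs d = refl

binVal-nonzeroBoolVecs : ∀ d → All (λ x → binVal x ≢ 0) (nonzeroBoolVecs d)
binVal-nonzeroBoolVecs zero    = All.[]
binVal-nonzeroBoolVecs (suc d) = AllP.++⁺
  (AllP.map⁺ (All.map (λ x≢0 2x≡0 → x≢0 (ℕP.*-cancelˡ-≡ _ 0 2 2x≡0)) (binVal-nonzeroBoolVecs d)))
  (AllP.map⁺ (All.universal (λ _ ()) (allBoolVecs d)))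

base : ℕ → ℕ
base d = 4 * kOf d

2^d<base : ∀ {d} → d ≥ 1 → 2 ^ d < base d
2^d<base {suc d} _ = 2≤n⇒n<4*[n∸1] (ℕP.*-monoʳ-≤ 2 (ℕP.m^n>0 2 d))

-- The point a_{binVal x} of X: liftPt d x, except that x = 0 gives a₀ = 0 instead of eLast d.
point : ∀ d → Vec Bool d → Vec ℤ (suc d)
point d x = Vec.map b2z x ∷ʳ ℤ.+ weight (base d) (binVal x)

lookup-point-inject₁ : ∀ d x j → Vec.lookup (point d x) (inject₁ j) ≡ b2z (Vec.lookup x j)
lookup-point-inject₁ d x j = trans (lookup-∷ʳ-inject₁ (Vec.map b2z x) _ j) (VecP.lookup-map j b2z x)

lookup-point-fromℕ : ∀ d x → Vec.lookup (point d x) (fromℕ d) ≡ ℤ.+ weight (base d) (binVal x)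
lookup-point-fromℕ d x = lookup-∷ʳ-fromℕ (Vec.map b2z x) _

point-injective : ∀ d → Injective _≡_ _≡_ (point d)
point-injective d eq = map-b2z-injective (VecP.∷ʳ-injectiveˡ _ _ eq)

point-replicate-false : ∀ d → point d (Vec.replicate d false) ≡ zeroV (suc d)
point-replicate-false d
  rewrite binVal-replicate-false d | VecP.map-replicate b2z false d = replicate-∷ʳ d 0ℤ

liftPt-replicate-false : ∀ d → liftPt d (Vec.replicate d false) ≡ eLast d
liftPt-replicate-false d rewrite binVal-replicate-false d | VecP.map-replicate b2z false d = refl

point≡liftPt : ∀ d x → binVal x ≢ 0 → point d x ≡ liftPt d x
point≡liftPt d x x≢0 = cong (λ w → Vec.map b2z x ∷ʳ ℤ.+ w) (weight-nonzero (binVal x) x≢0)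
  where
  weight-nonzero : ∀ e → e ≢ 0 → weight (base d) e ≡ base d ^ e
  weight-nonzero zero    0≢0 = ⊥-elim (0≢0 refl)
  weight-nonzero (suc e) _   = refl

liftPt≢eLast : ∀ d x → binVal x ≢ 0 → liftPt d x ≢ eLast d
liftPt≢eLast d x x≢0 eq = x≢0 (trans (cong binVal x≡0) (binVal-replicate-false d))
  where
  x≡0 : x ≡ Vec.replicate d false
  x≡0 = map-b2z-injective (trans (VecP.∷ʳ-injectiveˡ _ _ eq) (sym (VecP.map-replicate b2z false d)))

Xlist≡map-point : ∀ d → Xlist d ≡ map (point d) (allBoolVecs d)
Xlist≡map-point d rewrite allBoolVecs≡replicate-false∷nonzeroBoolVecs d =
  cong₂ _∷_ (sym (point-replicate-false d)) (begin
    filter ≢eLast? (liftPt d (Vec.replicate d false) ∷ map (liftPt d) nonzero)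
      ≡⟨ ListP.filter-reject ≢eLast? (λ ≢eLast → ≢eLast (liftPt-replicate-false d)) ⟩
    filter ≢eLast? (map (liftPt d) nonzero)
      ≡⟨ ListP.filter-all ≢eLast? (AllP.map⁺ (All.map (liftPt≢eLast d _) nonzero≢0)) ⟩
    map (liftPt d) nonzero
      ≡⟨ ListP.map-cong-local (All.map (point≡liftPt d _) nonzero≢0) ⟨
    map (point d) nonzero
      ∎)
  where
  open ≡-Reasoning
  nonzero : List (Vec Bool d)
  nonzero = nonzeroBoolVecs d
  nonzero≢0 : All (λ x → binVal x ≢ 0) nonzero
  nonzero≢0 = binVal-nonzeroBoolVecs d
  ≢eLast? : (p : Vec ℤ (suc d)) → Dec (p ≢ eLast d)
  ≢eLast? p = ¬? (≡-dec ℤ._≟_ p (eLast d))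

∈-Xlist⇒point : ∀ d {q} → q ∈ Xlist d → ∃ λ x → q ≡ point d x
∈-Xlist⇒point d q∈X with ∈-map⁻ (point d) (subst (_ ∈_) (Xlist≡map-point d) q∈X)
... | x , _ , q≡x = x , q≡x

∈-Xlist⇒IsBit : ∀ d {q} → q ∈ Xlist d → ∀ j → IsBit (Vec.lookup q (inject₁ j))
∈-Xlist⇒IsBit d q∈X j with ∈-Xlist⇒point d q∈X
... | x , refl = subst IsBit (sym (lookup-point-inject₁ d x j)) (b2z-IsBit (Vec.lookup x j))

∈-Xlist-determined : ∀ d {q q′} → q ∈ Xlist d → q′ ∈ Xlist d →
  (∀ j → Vec.lookup q (inject₁ j) ≡ Vec.lookup q′ (inject₁ j)) → q ≡ q′
∈-Xlist-determined d q∈X q′∈X agree with ∈-Xlist⇒point d q∈X | ∈-Xlist⇒point d q′∈X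
... | x , refl | x′ , refl = cong (point d) (lookup-injective λ j → b2z-injective
  (trans (sym (lookup-point-inject₁ d x j)) (trans (agree j) (lookup-point-inject₁ d x′ j))))

InP⇒∈Xlist : ∀ d {p} → InP d p → p ∈ Xlist d
InP⇒∈Xlist d {p} p∈P with InConv-bitDetermined⇒point (List.lookup (Xlist d)) inject₁ {p}
  (λ i → ∈-Xlist⇒IsBit d (∈-lookup i))
  (λ i i′ → ∈-Xlist-determined d (∈-lookup i) (∈-lookup i′)) p∈P
... | i , aᵢ≡p = subst (_∈ Xlist d) aᵢ≡p (∈-lookup i)

module Representation {d} (xs : List (Vec Bool d)) (∑xs≡t : vsum (map (point d) xs) ≡ tOf d) where

  coordinate-sum-≡ : ∀ r (g : Vec Bool d → ℕ) → (∀ x → Vec.lookup (point d x) r ≡ ℤ.+ g x) →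
    sum (map g xs) ≡ sum (map g (allBoolVecs d))
  coordinate-sum-≡ r g lookup≡g =
    vsum-map-≡⇒sum-map-≡ (point d) g r lookup≡g {xs} {allBoolVecs d}
      (trans ∑xs≡t (cong vsum (Xlist≡map-point d)))

  weight-expansion-≡ : sumBelow (2 ^ d) (λ e → count ℕ._≟_ e (map binVal xs) * weight (base d) e)
                     ≡ sumBelow (2 ^ d) (λ e → 1 * weight (base d) e)
  weight-expansion-≡ = begin
    sumBelow (2 ^ d) (λ e → count ℕ._≟_ e (map binVal xs) * w e)
      ≡⟨ sum-map-regroup (2 ^ d) w (AllP.map⁺ (All.universal binVal<2^d xs)) ⟨
    sum (map w (map binVal xs))
      ≡⟨ cong sum (ListP.map-∘ xs) ⟨
    sum (map (w ∘ binVal) xs)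
      ≡⟨ coordinate-sum-≡ (fromℕ d) (w ∘ binVal) (lookup-point-fromℕ d) ⟩
    sum (map (w ∘ binVal) (allBoolVecs d))
      ≡⟨ sum-map-binVal-allBoolVecs d w ⟩
    sumBelow (2 ^ d) w
      ≡⟨ sumBelow-cong (2 ^ d) (λ e → sym (*-identityˡ (w e))) ⟩
    sumBelow (2 ^ d) (λ e → 1 * w e)
      ∎
    where
    open ≡-Reasoning
    w : ℕ → ℕ
    w = weight (base d)

  count-binVal≤2^d : ∀ {e} → e ≢ 0 → count ℕ._≟_ e (map binVal xs) ≤ 2 ^ d
  count-binVal≤2^d {e} e≢0 with e ∈? map binVal xs
  ... | no e∉ = subst (_≤ 2 ^ d) (sym (∉⇒count≡0 ℕ._≟_ (map binVal xs) e∉)) z≤n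
  ... | yes e∈ with ∈-map⁻ binVal e∈
  ...   | x , _ , refl
    with some-bit-set x (λ x≡0 → e≢0 (trans (cong binVal x≡0) (binVal-replicate-false d)))
  ...     | j , xⱼ≡true = begin
    count ℕ._≟_ (binVal x) (map binVal xs)
      ≡⟨ count-map-injective _≟ᵇ_ ℕ._≟_ binVal-injective x xs ⟩
    count _≟ᵇ_ x xs
      ≤⟨ count≤sum-map _≟ᵇ_ (ℕP.≤-reflexive (cong bit (sym xⱼ≡true))) xs ⟩
    sum (map bitⱼ xs)
      ≡⟨ coordinate-sum-≡ (inject₁ j) bitⱼ (λ x → trans (lookup-point-inject₁ d x j) (b2z≡+bit _)) ⟩
    sum (map bitⱼ (allBoolVecs d))
      ≤⟨ sum-map-mono-≤ (λ x → bit≤1 (Vec.lookup x j)) (allBoolVecs d) ⟩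
    sum (map (λ _ → 1) (allBoolVecs d))
      ≡⟨ sum-map-binVal-allBoolVecs d (λ _ → 1) ⟩
    sumBelow (2 ^ d) (λ _ → 1)
      ≡⟨ sumBelow-one (2 ^ d) ⟩
    2 ^ d
      ∎
    where
    open ℕP.≤-Reasoning
    bitⱼ : Vec Bool d → ℕ
    bitⱼ x = bit (Vec.lookup x j)

  count≡1 : d ≥ 1 → ∀ y → y ≢ Vec.replicate d false → count _≟ᵇ_ y xs ≡ 1
  count≡1 d≥1 y y≢0 with binVal y in binVal-y≡
  ... | zero  = ⊥-elim (y≢0 (binVal-injective (trans binVal-y≡ (sym (binVal-replicate-false d)))))
  ... | suc e = begin
    count _≟ᵇ_ y xs
      ≡⟨ count-map-injective _≟ᵇ_ ℕ._≟_ binVal-injective y xs ⟨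
    count ℕ._≟_ (binVal y) (map binVal xs)
      ≡⟨ cong (λ e → count ℕ._≟_ e (map binVal xs)) binVal-y≡ ⟩
    count ℕ._≟_ (suc e) (map binVal xs)
      ≡⟨ weighted-digits-injective (base d) (2 ^ d)
           {λ e → count ℕ._≟_ e (map binVal xs)} {λ _ → 1}
           (λ e _ → count<base (suc e) (λ ()))
           (λ _ _ → ℕP.≤-<-trans (ℕP.m^n>0 2 d) 2^d<b)
           weight-expansion-≡ e (subst (_< 2 ^ d) binVal-y≡ (binVal<2^d y)) ⟩
    1
      ∎
    where
    open ≡-Reasoning
    2^d<b : 2 ^ d < base d
    2^d<b = 2^d<base d≥1
    instance
      base≢0 : NonZero (base d)
      base≢0 = ℕ.>-nonZero (ℕP.≤-trans (s≤s z≤n) 2^d<b)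
    count<base : ∀ e → e ≢ 0 → count ℕ._≟_ e (map binVal xs) < base d
    count<base e e≢0 = ℕP.≤-<-trans (count-binVal≤2^d e≢0) 2^d<b

lemma3 : (d : ℕ) → d ≥ 1 → (ps : List (Vec ℤ (suc d))) →
    All (InP d) ps → vsum ps ≡ tOf d →
    All (λ p → p ∈ Xlist d) ps ×
    ((q : Vec ℤ (suc d)) → q ∈ Xlist d → ¬ (q ≡ zeroV (suc d)) → countOcc q ps ≡ 1)
lemma3 d d≥1 ps ps⊆P ∑ps≡t = ps⊆X , countOcc≡1
  where
  ps⊆X : All (_∈ Xlist d) ps
  ps⊆X = All.map (InP⇒∈Xlist d) ps⊆P

  ps=map-point : ∃ λ xs → ps ≡ map (point d) xs
  ps=map-point = All-∈-map⇒≡map (subst (λ X → All (_∈ X) ps) (Xlist≡map-point d) ps⊆X)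

  countOcc≡1 : ∀ q → q ∈ Xlist d → q ≢ zeroV (suc d) → countOcc q ps ≡ 1
  countOcc≡1 q q∈X q≢0 with ps=map-point | ∈-Xlist⇒point d q∈X
  ... | xs , refl | y , refl = trans
    (count-map-injective _≟ᵇ_ (≡-dec ℤ._≟_) (point-injective d) y xs)
    (Representation.count≡1 xs ∑ps≡t d≥1 y
      (λ y≡0 → q≢0 (trans (cong (point d) y≡0) (point-replicate-false d))))
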